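{- Let $G$ and $H$ be finite connected simple graphs with $\Gamma(G)=\Gamma(H)=k$. Then $\Gamma(G\,\square\, H)\ge k+1$, unless $G=H=K_1$ or $G=H=K_2$.
   Context: The Cartesian product $G\,\square\, H$ has vertex set $V(G)\times V(H)$, and $(a,x)(b,y)$ is an edge iff either $a=b$ and $xy\in E(H)$, or $ab\in E(G)$ and $x=y$. A greedy $k$-colouring of a graph is a partition of its vertex set into $k$ nonempty stable sets $S_1,\dots,S_k$ such that for every $j<i$, every vertex of $S_i$ has a neighbour in $S_j$. The Grundy number $\Gamma$ is the largest such $k$. -}

module Defs where

open import Level using (0ℓ)
open import Data.Nat using (ℕ; _<_; _≥_; suc)
open import Data.Fin using (Fin; toℕ)
open import Data.Product using (Σ; ∃; _×_; _,_; proj₁; proj₂)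
open import Data.Sum using (_⊎_)
open import Relation.Nullary using (¬_; Dec)
open import Relation.Binary.PropositionalEquality using (_≡_; _≢_)
open import Relation.Binary.Construct.Closure.ReflexiveTransitive using (Star)
open import Function.Bundles using (_↔_)

record Graph : Set₁ where
  field
    Vertex : Set
    size   : ℕ
    enum   : Vertex ↔ Fin size
    Adj    : Vertex → Vertex → Set
    adj?   : ∀ u v → Dec (Adj u v)
    irrefl : ∀ v → ¬ Adj v v
    sym    : ∀ u v → Adj u v → Adj v u
open Graph public

Connected : Graph → Set
Connected G = Vertex G × (∀ u v → Star (Adj G) u v)

IsComplete : Graph → Set
IsComplete G = ∀ u v → u ≢ v → Adj G u v

IsK1 : Graph → Set
IsK1 G = size G ≡ 1

IsK2 : Graph → Set
IsK2 G = size G ≡ 2 × IsComplete G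

data ProdAdj (G H : Graph) : Vertex G × Vertex H → Vertex G × Vertex H → Set where
  right : ∀ {a x y} → Adj H x y → ProdAdj G H (a , x) (a , y)
  left  : ∀ {a b x} → Adj G a b → ProdAdj G H (a , x) (b , x)

open import Data.Fin.Properties using (_≟_)
open import Relation.Nullary using (yes; no)
open import Data.Product.Properties using (×-≡,≡←≡)
open import Function.Bundles using (Inverse; mk↔ₛ′)
import Data.Fin as F
open import Relation.Binary.PropositionalEquality using (refl; cong)
import Relation.Binary.PropositionalEquality as Eq
open import Data.Nat using (_*_)
open import Data.Fin.Properties using (remQuot-combine; combine-remQuot)

private
  decEq : (G : Graph) → (u v : Vertex G) → Dec (u ≡ v)
  decEq G u v with Inverse.to (enum G) u ≟ Inverse.to (enum G) v
  ... | yes p = yes (Eq.trans (Eq.sym (Inverse.strictlyInverseʳ (enum G) u))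
                     (Eq.trans (cong (Inverse.from (enum G)) p)
                               (Inverse.strictlyInverseʳ (enum G) v)))
  ... | no np = no (λ e → np (cong (Inverse.to (enum G)) e))

_□_ : Graph → Graph → Graph
G □ H = record
  { Vertex = Vertex G × Vertex H
  ; size   = size G * size H
  ; enum   = mk↔ₛ′ to from to∘from from∘to
  ; Adj    = ProdAdj G H
  ; adj?   = dec
  ; irrefl = irr
  ; sym    = sy
  }
  where
  eG = enum G
  eH = enum H
  to : Vertex G × Vertex H → Fin (size G * size H)
  to (a , x) = F.combine (Inverse.to eG a) (Inverse.to eH x)
  from : Fin (size G * size H) → Vertex G × Vertex H
  from i = Inverse.from eG (proj₁ (F.remQuot {size G} (size H) i)) , Inverse.from eH (proj₂ (F.remQuot {size G} (size H) i))
  to∘from : ∀ i → to (from i) ≡ i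
  to∘from i = Eq.trans (Eq.cong₂ F.combine
                   (Inverse.strictlyInverseˡ eG (proj₁ (F.remQuot {size G} (size H) i)))
                   (Inverse.strictlyInverseˡ eH (proj₂ (F.remQuot {size G} (size H) i))))
                 (combine-remQuot {size G} (size H) i)
  from∘to : ∀ v → from (to v) ≡ v
  from∘to (a , x) = Eq.cong₂ _,_
      (Eq.trans (Eq.cong (λ z → Inverse.from eG (proj₁ z)) rc) (Inverse.strictlyInverseʳ eG a))
      (Eq.trans (Eq.cong (λ z → Inverse.from eH (proj₂ z)) rc) (Inverse.strictlyInverseʳ eH x))
    where rc = remQuot-combine {size G} {size H} (Inverse.to eG a) (Inverse.to eH x)
  dec : ∀ u v → Dec (ProdAdj G H u v)
  dec (a , x) (b , y) with decEq G a b | decEq H x y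
  dec (a , x) (.a , y) | yes refl | _ with adj? H x y
  ... | yes h = yes (right h)
  ... | no nh = no λ { (right h) → nh h ; (left g) → irrefl G a g }
  dec (a , x) (b , .x) | no _ | yes refl with adj? G a b
  ... | yes g = yes (left g)
  ... | no ng = no λ { (right h) → irrefl H x h ; (left g) → ng g }
  dec (a , x) (b , y) | no na | no nx = no λ { (right _) → na refl ; (left _) → nx refl }
  irr : ∀ v → ¬ ProdAdj G H v v
  irr (a , x) (right h) = irrefl H x h
  irr (a , x) (left g) = irrefl G a g
  sy : ∀ u v → ProdAdj G H u v → ProdAdj G H v u
  sy _ _ (right h) = right (sym H _ _ h)
  sy _ _ (left g) = left (sym G _ _ g)

record GreedyColouring (G : Graph) (k : ℕ) : Set where
  field
    colour   : Vertex G → Fin k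
    nonempty : ∀ i → ∃ λ v → colour v ≡ i
    stable   : ∀ u v → Adj G u v → colour u ≢ colour v
    greedy   : ∀ v (j : Fin k) → toℕ j < toℕ (colour v) →
               ∃ λ u → Adj G v u × colour u ≡ j

GrundyIs : Graph → ℕ → Set
GrundyIs G k = GreedyColouring G k × (∀ m → GreedyColouring G m → m Data.Nat.≤ k)

GrundyAtLeast : Graph → ℕ → Set
GrundyAtLeast G k = ∃ λ m → m ≥ k × GreedyColouring G m

-- A partial colouring that is stable and greedy on its support (a greedy colouring of an
-- induced subgraph) extends to a greedy colouring of the whole graph: colour the remaining
-- vertices one at a time with the least colour missing among their neighbours.  So Γ exceeds
-- every colour such a partial colouring uses, and it suffices to exhibit one using colour k.
--
-- k ≤ 1 forces both graphs to be K₁.  For k = 2, a connected graph with an edge is K₂ or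
-- contains a path a–b–c; P₃ □ K₂ contains a path v₀v₁v₂v₃ with nonadjacent ends, coloured
-- 0, 1, 2, 0.  For k ≥ 3, a vertex of colour k − 1 in H has neighbours of colours 0 and 1,
-- a copy of K₁,₂.  Colour (a , s) in the resulting copy of G □ K₁,₂ by a table entry indexed
-- by s and the colour of a in a greedy k-colouring of G; two explicit tables, according to
-- the parity of k, reach the colour k.

module Submission where

open import Defs
open import Data.Nat using (ℕ; zero; suc; _+_; _≤_; _<_; z≤n; s≤s)
open import Data.Nat.Properties
open import Data.Fin using (Fin; toℕ; fromℕ; fromℕ<)
open import Data.Fin.Patterns using (0F; 1F; 2F; 3F)
import Data.Fin.Properties as Fin
open import Data.Fin.Permutation using (↔⇒≡)
open import Data.Maybe using (Maybe; just; nothing; _>>=_)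
open import Data.Maybe.Properties using (just-injective)
import Data.Maybe.Properties as Maybe
open import Data.Product using (∃; ∃₂; _×_; _,_; proj₁; proj₂)
open import Data.Sum using (_⊎_; inj₁; inj₂)
open import Data.Empty using (⊥; ⊥-elim)
open import Data.List using (List; []; _∷_; map; allFin; cartesianProduct)
open import Data.List.Membership.Propositional using (_∈_)
open import Data.List.Membership.Propositional.Properties
  using (∈-map⁺; ∈-allFin; ∈-cartesianProduct⁺)
open import Data.List.Relation.Unary.Any using (here; there)
import Data.List.Relation.Unary.All as All
import Data.List.Extrema.Nat as Extrema
open import Relation.Nullary using (¬_; Dec; yes; no)
open import Relation.Nullary.Decidable using (map′; _×-dec_; _⊎-dec_; ¬?; decidable-stable)
open import Relation.Binary.Definitions using (DecidableEquality)
open import Relation.Binary.PropositionalEquality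
  using (_≡_; _≢_; refl; trans; cong; subst) renaming (sym to ≡-sym)
open import Relation.Binary.Construct.Closure.ReflexiveTransitive using (Star; ε; _◅_)
open import Function using (_∘_)
open import Function.Definitions using (Injective)
open import Function.Bundles using (Inverse; _↔_; mk↔ₛ′)
open import Function.Properties.Inverse using (↔⇒↣; ↔-sym; ↔-trans)

module _ (G : Graph) where

  _≟ᵛ_ : DecidableEquality (Vertex G)
  _≟ᵛ_ = Fin.inj⇒≟ (↔⇒↣ (enum G))

  adj⇒≢ : ∀ {u v} → Adj G u v → u ≢ v
  adj⇒≢ {u} a refl = irrefl G u a

  any-vertex? : {P : Vertex G → Set} → (∀ v → Dec (P v)) → Dec (∃ P)
  any-vertex? {P} P? = map′ (λ (i , p) → Inverse.from (enum G) i , p)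
    (λ (v , p) → Inverse.to (enum G) v , subst P (≡-sym (Inverse.strictlyInverseʳ (enum G) v)) p)
    (Fin.any? (λ i → P? (Inverse.from (enum G) i)))

  vertices : List (Vertex G)
  vertices = map (Inverse.from (enum G)) (allFin (size G))

  ∈-vertices : ∀ v → v ∈ vertices
  ∈-vertices v = subst (_∈ vertices) (Inverse.strictlyInverseʳ (enum G) v)
    (∈-map⁺ (Inverse.from (enum G)) (∈-allFin (Inverse.to (enum G) v)))

  size-unique : ∀ {m} → Vertex G ↔ Fin m → size G ≡ m
  size-unique e = ↔⇒≡ (↔-trans (↔-sym (enum G)) e)

-- Extending partial greedy colourings

record IsPartialGreedy {A : Set} (R : A → A → Set) (p : A → Maybe ℕ) (B : ℕ) : Set where
  field
    stable  : ∀ {u v i} → R u v → p u ≡ just i → p v ≢ just i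
    greedy  : ∀ {v c j} → p v ≡ just c → j < c → ∃ λ u → R v u × p u ≡ just j
    bounded : ∀ {v c} → p v ≡ just c → c < B
open IsPartialGreedy

IsPartialGreedy-resp : ∀ {A} {R : A → A → Set} {p q B} → (∀ u → p u ≡ q u) →
                       IsPartialGreedy R p B → IsPartialGreedy R q B
IsPartialGreedy-resp {p = p} {q} p≗q P = record
  { stable  = λ r qu qv → stable P r (from qu) (from qv)
  ; greedy  = λ qv j<c → let u , r , pu = greedy P (from qv) j<c in u , r , to pu
  ; bounded = λ qv → bounded P (from qv)
  }
  where
  from : ∀ {u c} → q u ≡ just c → p u ≡ just c
  from {u} = trans (p≗q u)
  to : ∀ {u c} → p u ≡ just c → q u ≡ just c
  to {u} = trans (≡-sym (p≗q u))

_⊑_ : ∀ {A : Set} → (A → Maybe ℕ) → (A → Maybe ℕ) → Set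
p ⊑ q = ∀ {u c} → p u ≡ just c → q u ≡ just c

least-failure : (P : ℕ → Set) → (∀ j → Dec (P j)) → ∀ {B} → ¬ P B →
                ∃ λ m → ¬ P m × (∀ {j} → j < m → P j) × m ≤ B
least-failure P P? {B} ¬PB with Fin.¬∀⟶∃¬-smallest (suc B) (λ i → P (toℕ i)) (λ i → P? (toℕ i))
                                    (λ ∀P → ¬PB (subst P (Fin.toℕ-fromℕ B) (∀P (fromℕ B))))
... | i , ¬Pi , below = toℕ i , ¬Pi , below′ , Fin.toℕ≤pred[n] i
  where
  below′ : ∀ {j} → j < toℕ i → P j
  below′ j<i = subst P (trans (Fin.toℕ-inject (fromℕ< j<i)) (Fin.toℕ-fromℕ< j<i)) (below (fromℕ< j<i))

module _ {G : Graph} where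

  _[_≔_] : (Vertex G → Maybe ℕ) → Vertex G → ℕ → Vertex G → Maybe ℕ
  (p [ v ≔ m ]) u with _≟ᵛ_ G u v
  ... | yes _ = just m
  ... | no  _ = p u

  update-just : ∀ {p v m u c} → (p [ v ≔ m ]) u ≡ just c → (u ≡ v × m ≡ c) ⊎ (u ≢ v × p u ≡ just c)
  update-just {v = v} {u = u} e with _≟ᵛ_ G u v
  ... | yes u≡v = inj₁ (u≡v , just-injective e)
  ... | no  u≢v = inj₂ (u≢v , e)

  update-here : ∀ {p v m} → (p [ v ≔ m ]) v ≡ just m
  update-here {v = v} with _≟ᵛ_ G v v
  ... | yes _   = refl
  ... | no  v≢v = ⊥-elim (v≢v refl)

  update-extends : ∀ {p v m} → p v ≡ nothing → p ⊑ (p [ v ≔ m ])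
  update-extends {v = v} pv≡nothing {u} pu with _≟ᵛ_ G u v
  ... | yes refl with () ← trans (≡-sym pv≡nothing) pu
  ... | no  _ = pu

  NeighbourColoured : (Vertex G → Maybe ℕ) → Vertex G → ℕ → Set
  NeighbourColoured p v j = ∃ λ u → Adj G v u × p u ≡ just j

  neighbourColoured? : ∀ p v j → Dec (NeighbourColoured p v j)
  neighbourColoured? p v j = any-vertex? G (λ u → adj? G v u ×-dec Maybe.≡-dec _≟_ (p u) (just j))

  colour-vertex : ∀ {p B v} → IsPartialGreedy (Adj G) p B → p v ≡ nothing →
                  ∃ λ m → IsPartialGreedy (Adj G) (p [ v ≔ m ]) (suc B)
  colour-vertex {p} {B} {v} P pv≡nothing
    with least-failure (NeighbourColoured p v) (neighbourColoured? p v)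
                       (λ (_ , _ , pu) → <-irrefl refl (bounded P pu))
  ... | m , m-free , below-m , m≤B = m , record
    { stable  = stable′
    ; greedy  = greedy′
    ; bounded = bounded′
    }
    where
    stable′ : ∀ {u w i} → Adj G u w → (p [ v ≔ m ]) u ≡ just i → (p [ v ≔ m ]) w ≢ just i
    stable′ a pu pw with update-just pu | update-just pw
    ... | inj₁ (refl , _)    | inj₁ (refl , _)    = irrefl G _ a
    ... | inj₁ (refl , refl) | inj₂ (_ , pw′)     = m-free (_ , a , pw′)
    ... | inj₂ (_ , pu′)     | inj₁ (refl , refl) = m-free (_ , sym G _ _ a , pu′)
    ... | inj₂ (_ , pu′)     | inj₂ (_ , pw′)     = stable P a pu′ pw′

    greedy′ : ∀ {u c j} → (p [ v ≔ m ]) u ≡ just c → j < c →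
              ∃ λ w → Adj G u w × (p [ v ≔ m ]) w ≡ just j
    greedy′ pu j<c with update-just pu
    ... | inj₁ (refl , refl) = let w , a , pw = below-m j<c in w , a , update-extends pv≡nothing pw
    ... | inj₂ (_ , pu′)     = let w , a , pw = greedy P pu′ j<c in w , a , update-extends pv≡nothing pw

    bounded′ : ∀ {u c} → (p [ v ≔ m ]) u ≡ just c → c < suc B
    bounded′ pu with update-just pu
    ... | inj₁ (_ , refl) = s≤s m≤B
    ... | inj₂ (_ , pu′)  = m<n⇒m<1+n (bounded P pu′)

  colour-all : ∀ {p B} (vs : List (Vertex G)) → IsPartialGreedy (Adj G) p B →
               ∃₂ λ q B′ → IsPartialGreedy (Adj G) q B′ × p ⊑ q × (∀ {u} → u ∈ vs → ∃ λ c → q u ≡ just c)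
  colour-all {p} {B} [] P = p , B , P , (λ pu → pu) , λ ()
  colour-all {p} (v ∷ vs) P with p v in pv
  ... | just c with colour-all vs P
  ...   | q , B′ , Q , p⊑q , covers =
    q , B′ , Q , p⊑q , λ { (here refl) → c , p⊑q pv ; (there u∈vs) → covers u∈vs }
  colour-all {p} (v ∷ vs) P | nothing with colour-vertex P pv
  ... | m , P′ with colour-all vs P′
  ...   | q , B′ , Q , p′⊑q , covers =
    q , B′ , Q , (λ pu → p′⊑q (update-extends pv pu)) ,
    λ { (here refl) → m , p′⊑q update-here ; (there u∈vs) → covers u∈vs }

  extend-to-total : ∀ {p B} → IsPartialGreedy (Adj G) p B →
                    ∃₂ λ c B′ → IsPartialGreedy (Adj G) (just ∘ c) B′ × p ⊑ (just ∘ c)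
  extend-to-total P with colour-all (vertices G) P
  ... | q , B′ , Q , p⊑q , covers =
    c , B′ , IsPartialGreedy-resp c-correct Q , (λ {u} pu → trans (≡-sym (c-correct u)) (p⊑q pu))
    where
    c : Vertex G → ℕ
    c u = proj₁ (covers (∈-vertices G u))
    c-correct : ∀ u → q u ≡ just (c u)
    c-correct u = proj₂ (covers (∈-vertices G u))

  total⇒GreedyColouring : ∀ {c B} → IsPartialGreedy (Adj G) (just ∘ c) B →
                          ∀ w → (∀ u → c u ≤ c w) → GreedyColouring G (suc (c w))
  total⇒GreedyColouring {c} P w maximal = record
    { colour   = colour
    ; nonempty = nonempty
    ; stable   = λ u v a eq → stable P a refl (cong just (colour-≡⇒c-≡ (≡-sym eq)))
    ; greedy   = greedy′
    }
    where
    colour : Vertex G → Fin (suc (c w))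
    colour u = fromℕ< (s≤s (maximal u))
    toℕ-colour : ∀ u → toℕ (colour u) ≡ c u
    toℕ-colour u = Fin.toℕ-fromℕ< (s≤s (maximal u))
    colour-≡ : ∀ {u i} → c u ≡ toℕ i → colour u ≡ i
    colour-≡ {u} e = Fin.toℕ-injective (trans (toℕ-colour u) e)
    colour-≡⇒c-≡ : ∀ {u v} → colour u ≡ colour v → c u ≡ c v
    colour-≡⇒c-≡ {u} {v} e = trans (≡-sym (toℕ-colour u)) (trans (cong toℕ e) (toℕ-colour v))
    nonempty : ∀ i → ∃ λ v → colour v ≡ i
    nonempty i with m≤n⇒m<n∨m≡n (Fin.toℕ≤pred[n] i)
    ... | inj₂ i≡w = w , colour-≡ (≡-sym i≡w)
    ... | inj₁ i<w = let u , _ , cu = greedy P refl i<w in u , colour-≡ (just-injective cu)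
    greedy′ : ∀ v (j : Fin (suc (c w))) → toℕ j < toℕ (colour v) → ∃ λ u → Adj G v u × colour u ≡ j
    greedy′ v j j<v = let u , a , cu = greedy P refl (subst (toℕ j <_) (toℕ-colour v) j<v)
                      in u , a , colour-≡ (just-injective cu)

  partialGreedy⇒GrundyAtLeast : ∀ {p B v m} → IsPartialGreedy (Adj G) p B → p v ≡ just m →
                                GrundyAtLeast G (suc m)
  partialGreedy⇒GrundyAtLeast {v = v} {m} P pv with extend-to-total P
  ... | c , _ , C , p⊑c = suc (c w) , s≤s m≤w , total⇒GreedyColouring C w maximal
    where
    w = Extrema.argmax c v (vertices G)
    m≤w : m ≤ c w
    m≤w = subst (_≤ c w) (just-injective (p⊑c pv)) (Extrema.f[⊥]≤f[argmax] {f = c} v (vertices G))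
    maximal : ∀ u → c u ≤ c w
    maximal u = All.lookup (Extrema.f[xs]≤f[argmax] {f = c} v (vertices G)) (∈-vertices G u)

module _ {T : Set} {G : Graph} (emb : T → Vertex G) where

  preimage : List T → Vertex G → Maybe T
  preimage []       z = nothing
  preimage (t ∷ ts) z with _≟ᵛ_ G (emb t) z
  ... | yes _ = just t
  ... | no  _ = preimage ts z

  preimage-sound : ∀ ts {z t} → preimage ts z ≡ just t → emb t ≡ z
  preimage-sound (t ∷ ts) {z} e with _≟ᵛ_ G (emb t) z
  preimage-sound (t ∷ ts) refl | yes et≡z = et≡z
  ... | no _ = preimage-sound ts e

  preimage-complete : Injective _≡_ _≡_ emb → ∀ {ts t} → t ∈ ts → preimage ts (emb t) ≡ just t
  preimage-complete inj {t′ ∷ ts} {t} t∈ with _≟ᵛ_ G (emb t′) (emb t) | t∈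
  ... | yes e  | _             = cong just (inj e)
  ... | no ne  | here refl     = ⊥-elim (ne refl)
  ... | no _   | there t∈ts    = preimage-complete inj t∈ts

  module _ (emb-injective : Injective _≡_ _≡_ emb) (ts : List T) (∈-ts : ∀ t → t ∈ ts)
           {κ : T → Maybe ℕ} where

    transfer : Vertex G → Maybe ℕ
    transfer z = preimage ts z >>= κ

    transfer-emb : ∀ t → transfer (emb t) ≡ κ t
    transfer-emb t rewrite preimage-complete emb-injective (∈-ts t) = refl

    transfer-just : ∀ {z c} → transfer z ≡ just c → ∃ λ t → emb t ≡ z × κ t ≡ just c
    transfer-just {z} e with preimage ts z in pz
    ... | just t = t , preimage-sound ts pz , e

    transfer-partialGreedy : ∀ {B} → IsPartialGreedy (λ t t′ → Adj G (emb t) (emb t′)) κ B →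
                             IsPartialGreedy (Adj G) transfer B
    transfer-partialGreedy K = record
      { stable  = λ a pu pv → stable′ a (transfer-just pu) (transfer-just pv)
      ; greedy  = greedy′
      ; bounded = λ pv → let _ , _ , κt = transfer-just pv in bounded K κt
      }
      where
      stable′ : ∀ {u v i} → Adj G u v → (∃ λ t → emb t ≡ u × κ t ≡ just i) →
                (∃ λ t → emb t ≡ v × κ t ≡ just i) → ⊥
      stable′ a (_ , refl , κt) (_ , refl , κt′) = stable K a κt κt′
      greedy′ : ∀ {v c j} → transfer v ≡ just c → j < c → ∃ λ u → Adj G v u × transfer u ≡ just j
      greedy′ pv j<c with transfer-just pv
      ... | t , refl , κt = let t′ , a , κt′ = greedy K κt j<c in emb t′ , a , trans (transfer-emb t′) κt′

    embedded-partialGreedy⇒GrundyAtLeast : ∀ {B t m} →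
      IsPartialGreedy (λ t t′ → Adj G (emb t) (emb t′)) κ B → κ t ≡ just m → GrundyAtLeast G (suc m)
    embedded-partialGreedy⇒GrundyAtLeast {t = t} K κt =
      partialGreedy⇒GrundyAtLeast (transfer-partialGreedy K) (trans (transfer-emb t) κt)

module _ {G : Graph} {v₀ v₁ v₂ v₃ : Vertex G}
         (a₀₁ : Adj G v₀ v₁) (a₁₂ : Adj G v₁ v₂) (a₂₃ : Adj G v₂ v₃)
         (v₀≢v₂ : v₀ ≢ v₂) (v₁≢v₃ : v₁ ≢ v₃) (v₀≢v₃ : v₀ ≢ v₃) (¬a₀₃ : ¬ Adj G v₀ v₃) where

  private
    path : Fin 4 → Vertex G
    path 0F = v₀
    path 1F = v₁
    path 2F = v₂
    path 3F = v₃

    path-injective : Injective _≡_ _≡_ path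
    path-injective {0F} {0F} _ = refl
    path-injective {0F} {1F} e = ⊥-elim (adj⇒≢ G a₀₁ e)
    path-injective {0F} {2F} e = ⊥-elim (v₀≢v₂ e)
    path-injective {0F} {3F} e = ⊥-elim (v₀≢v₃ e)
    path-injective {1F} {0F} e = ⊥-elim (adj⇒≢ G a₀₁ (≡-sym e))
    path-injective {1F} {1F} _ = refl
    path-injective {1F} {2F} e = ⊥-elim (adj⇒≢ G a₁₂ e)
    path-injective {1F} {3F} e = ⊥-elim (v₁≢v₃ e)
    path-injective {2F} {0F} e = ⊥-elim (v₀≢v₂ (≡-sym e))
    path-injective {2F} {1F} e = ⊥-elim (adj⇒≢ G a₁₂ (≡-sym e))
    path-injective {2F} {2F} _ = refl
    path-injective {2F} {3F} e = ⊥-elim (adj⇒≢ G a₂₃ e)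
    path-injective {3F} {0F} e = ⊥-elim (v₀≢v₃ (≡-sym e))
    path-injective {3F} {1F} e = ⊥-elim (v₁≢v₃ (≡-sym e))
    path-injective {3F} {2F} e = ⊥-elim (adj⇒≢ G a₂₃ (≡-sym e))
    path-injective {3F} {3F} _ = refl

    colour : Fin 4 → ℕ
    colour 0F = 0
    colour 1F = 1
    colour 2F = 2
    colour 3F = 0

    colour-partialGreedy : IsPartialGreedy (λ t t′ → Adj G (path t) (path t′)) (just ∘ colour) 3
    colour-partialGreedy = record { stable = stable′ ; greedy = greedy′ ; bounded = bounded′ }
      where
      stable′ : ∀ {t t′ i} → Adj G (path t) (path t′) → just (colour t) ≡ just i → just (colour t′) ≢ just i
      stable′ {0F} {0F} a _ _ = irrefl G _ a
      stable′ {1F} {1F} a _ _ = irrefl G _ a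
      stable′ {2F} {2F} a _ _ = irrefl G _ a
      stable′ {3F} {3F} a _ _ = irrefl G _ a
      stable′ {0F} {3F} a _ _ = ¬a₀₃ a
      stable′ {3F} {0F} a _ _ = ¬a₀₃ (sym G _ _ a)
      stable′ {0F} {1F} _ refl ()
      stable′ {0F} {2F} _ refl ()
      stable′ {1F} {0F} _ refl ()
      stable′ {1F} {2F} _ refl ()
      stable′ {1F} {3F} _ refl ()
      stable′ {2F} {0F} _ refl ()
      stable′ {2F} {1F} _ refl ()
      stable′ {2F} {3F} _ refl ()
      stable′ {3F} {1F} _ refl ()
      stable′ {3F} {2F} _ refl ()
      greedy′ : ∀ {t c j} → just (colour t) ≡ just c → j < c →
                ∃ λ t′ → Adj G (path t) (path t′) × just (colour t′) ≡ just j
      greedy′ {0F} refl ()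
      greedy′ {1F} refl (s≤s z≤n)       = 0F , sym G _ _ a₀₁ , refl
      greedy′ {2F} refl (s≤s z≤n)       = 3F , a₂₃ , refl
      greedy′ {2F} refl (s≤s (s≤s z≤n)) = 1F , sym G _ _ a₁₂ , refl
      greedy′ {3F} refl ()
      bounded′ : ∀ {t c} → just (colour t) ≡ just c → c < 3
      bounded′ {0F} refl = s≤s z≤n
      bounded′ {1F} refl = s≤s (s≤s z≤n)
      bounded′ {2F} refl = s≤s (s≤s (s≤s z≤n))
      bounded′ {3F} refl = s≤s z≤n

  path₄⇒GrundyAtLeast3 : GrundyAtLeast G 3
  path₄⇒GrundyAtLeast3 =
    embedded-partialGreedy⇒GrundyAtLeast {G = G} path path-injective (allFin 4) ∈-allFin
      {t = 2F} colour-partialGreedy refl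

-- Greedy colourings of products

□-adj : ∀ {G H a b x y} → ProdAdj G H (a , x) (b , y) → (a ≡ b × Adj H x y) ⊎ (Adj G a b × x ≡ y)
□-adj (right h) = inj₁ (refl , h)
□-adj (left g)  = inj₂ (g , refl)

□-nonadjacent : ∀ {G H a b x y} → a ≢ b → x ≢ y → ¬ ProdAdj G H (a , x) (b , y)
□-nonadjacent a≢b x≢y (right _) = a≢b refl
□-nonadjacent a≢b x≢y (left _)  = x≢y refl

data K₁₂ : Set where
  hub leaf₁ leaf₂ : K₁₂

data K₁₂-Adj : K₁₂ → K₁₂ → Set where
  hub-leaf₁ : K₁₂-Adj hub leaf₁
  leaf₁-hub : K₁₂-Adj leaf₁ hub
  hub-leaf₂ : K₁₂-Adj hub leaf₂
  leaf₂-hub : K₁₂-Adj leaf₂ hub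

k₁₂-vertices : List K₁₂
k₁₂-vertices = hub ∷ leaf₁ ∷ leaf₂ ∷ []

∈-k₁₂-vertices : ∀ s → s ∈ k₁₂-vertices
∈-k₁₂-vertices hub   = here refl
∈-k₁₂-vertices leaf₁ = there (here refl)
∈-k₁₂-vertices leaf₂ = there (there (here refl))

-- Not necessarily induced: the two leaves may be adjacent.
record K₁₂-Subgraph (G : Graph) : Set where
  field
    embed          : K₁₂ → Vertex G
    embed-injective : Injective _≡_ _≡_ embed
    embed-adj      : ∀ {s s′} → K₁₂-Adj s s′ → Adj G (embed s) (embed s′)
open K₁₂-Subgraph

embed-leaves-distinct : ∀ {G} (S : K₁₂-Subgraph G) → embed S leaf₁ ≢ embed S leaf₂
embed-leaves-distinct S e with embed-injective S e
... | ()

k₁₂-subgraph : ∀ {G h l₁ l₂} → Adj G h l₁ → Adj G h l₂ → l₁ ≢ l₂ → K₁₂-Subgraph G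
k₁₂-subgraph {G} {h} {l₁} {l₂} a₁ a₂ l₁≢l₂ = record
  { embed = embed′ ; embed-injective = injective ; embed-adj = adjacent }
  where
  embed′ : K₁₂ → Vertex G
  embed′ hub   = h
  embed′ leaf₁ = l₁
  embed′ leaf₂ = l₂
  injective : Injective _≡_ _≡_ embed′
  injective {hub}   {hub}   _ = refl
  injective {hub}   {leaf₁} e = ⊥-elim (adj⇒≢ G a₁ e)
  injective {hub}   {leaf₂} e = ⊥-elim (adj⇒≢ G a₂ e)
  injective {leaf₁} {hub}   e = ⊥-elim (adj⇒≢ G a₁ (≡-sym e))
  injective {leaf₁} {leaf₁} _ = refl
  injective {leaf₁} {leaf₂} e = ⊥-elim (l₁≢l₂ e)
  injective {leaf₂} {hub}   e = ⊥-elim (adj⇒≢ G a₂ (≡-sym e))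
  injective {leaf₂} {leaf₁} e = ⊥-elim (l₁≢l₂ (≡-sym e))
  injective {leaf₂} {leaf₂} _ = refl
  adjacent : ∀ {s s′} → K₁₂-Adj s s′ → Adj G (embed′ s) (embed′ s′)
  adjacent hub-leaf₁ = a₁
  adjacent leaf₁-hub = sym G _ _ a₁
  adjacent hub-leaf₂ = a₂
  adjacent leaf₂-hub = sym G _ _ a₂

module _ {G H : Graph} where

  K₁₂□edge⇒GrundyAtLeast3 : K₁₂-Subgraph G → ∀ {x y} → Adj H x y → GrundyAtLeast (G □ H) 3
  K₁₂□edge⇒GrundyAtLeast3 S x~y = path₄⇒GrundyAtLeast3 {G = G □ H}
    (left (embed-adj S leaf₁-hub)) (right x~y) (left (embed-adj S hub-leaf₂))
    (x≢y ∘ cong proj₂) (x≢y ∘ cong proj₂) (l₁≢l₂ ∘ cong proj₁) (□-nonadjacent l₁≢l₂ x≢y)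
    where
    x≢y = adj⇒≢ H x~y
    l₁≢l₂ = embed-leaves-distinct S

  edge□K₁₂⇒GrundyAtLeast3 : ∀ {a b} → Adj G a b → K₁₂-Subgraph H → GrundyAtLeast (G □ H) 3
  edge□K₁₂⇒GrundyAtLeast3 a~b S = path₄⇒GrundyAtLeast3 {G = G □ H}
    (right (embed-adj S leaf₁-hub)) (left a~b) (right (embed-adj S hub-leaf₂))
    (a≢b ∘ cong proj₁) (a≢b ∘ cong proj₁) (a≢b ∘ cong proj₁) (□-nonadjacent a≢b l₁≢l₂)
    where
    a≢b = adj⇒≢ G a~b
    l₁≢l₂ = embed-leaves-distinct S

-- entry s i is the colour of (a , s) in G □ K₁₂ for every a in the i-th colour class of G.
record Table (k : ℕ) : Set where
  field
    entry           : K₁₂ → ℕ → Maybe ℕ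
    column-distinct : ∀ {s s′ i c} → s ≢ s′ → entry s i ≡ just c → entry s′ i ≢ just c
    row-injective   : ∀ {s i i′ c} → entry s i ≡ just c → entry s i′ ≡ just c → i ≡ i′
    supported       : ∀ {s i c j} → entry s i ≡ just c → j < c →
                      (∃ λ i′ → i′ < i × entry s i′ ≡ just j) ⊎
                      (∃ λ s′ → K₁₂-Adj s s′ × entry s′ i ≡ just j)
    bounded         : ∀ {s i c} → i < k → entry s i ≡ just c → c ≤ k
    top             : ∃ λ i → i < k × entry leaf₁ i ≡ just k

module _ {G H : Graph} {k} (C : GreedyColouring G k) (S : K₁₂-Subgraph H) (T : Table k) where
  open GreedyColouring C using (colour; nonempty)
  open Table T

  private
    emb : Vertex G × K₁₂ → Vertex (G □ H)
    emb (a , s) = a , embed S s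

    emb-injective : Injective _≡_ _≡_ emb
    emb-injective {a , s} {b , s′} e with cong proj₁ e | embed-injective S (cong proj₂ e)
    ... | refl | refl = refl

    κ : Vertex G × K₁₂ → Maybe ℕ
    κ (a , s) = entry s (toℕ (colour a))

    toℕ-colour : ∀ {a i} (i<k : i < k) → colour a ≡ fromℕ< i<k → toℕ (colour a) ≡ i
    toℕ-colour i<k ca = trans (cong toℕ ca) (Fin.toℕ-fromℕ< i<k)

    κ-partialGreedy : IsPartialGreedy (λ u v → ProdAdj G H (emb u) (emb v)) κ (suc k)
    κ-partialGreedy = record
      { stable  = stable′
      ; greedy  = greedy′
      ; bounded = λ {v} e → s≤s (Table.bounded T (Fin.toℕ<n (colour (proj₁ v))) e)
      }
      where
      stable′ : ∀ {u v i} → ProdAdj G H (emb u) (emb v) → κ u ≡ just i → κ v ≢ just i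
      stable′ {a , s} {b , s′} uv κu κv with □-adj uv
      ... | inj₁ (refl , h) = column-distinct (λ { refl → irrefl H _ h }) κu κv
      ... | inj₂ (g , e) with embed-injective S e
      ...   | refl = GreedyColouring.stable C a b g (Fin.toℕ-injective (row-injective κu κv))
      greedy′ : ∀ {v c j} → κ v ≡ just c → j < c → ∃ λ u → ProdAdj G H (emb v) (emb u) × κ u ≡ just j
      greedy′ {a , s} κv j<c with supported κv j<c
      ... | inj₂ (s′ , ss′ , e) = (a , s′) , right (embed-adj S ss′) , e
      ... | inj₁ (i′ , i′<i , e) =
        let i′<k = <-trans i′<i (Fin.toℕ<n (colour a))
            b , ab , cb = GreedyColouring.greedy C a (fromℕ< i′<k)
                            (subst (_< toℕ (colour a)) (≡-sym (Fin.toℕ-fromℕ< i′<k)) i′<i)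
        in (b , s) , left ab , subst (λ i → entry s i ≡ just _) (≡-sym (toℕ-colour i′<k cb)) e

  table⇒GrundyAtLeast : GrundyAtLeast (G □ H) (suc k)
  table⇒GrundyAtLeast with top
  ... | i , i<k , e with nonempty (fromℕ< i<k)
  ...   | a , ca =
    embedded-partialGreedy⇒GrundyAtLeast {G = G □ H} emb emb-injective
      (cartesianProduct (vertices G) k₁₂-vertices)
      (λ (a , s) → ∈-cartesianProduct⁺ (∈-vertices G a) (∈-k₁₂-vertices s))
      {t = a , leaf₁} κ-partialGreedy
      (subst (λ i → entry leaf₁ i ≡ just k) (≡-sym (toℕ-colour i<k ca)) e)

-- The two tables

retraction⇒injective : ∀ {f g : ℕ → ℕ} → (∀ n → g (f n) ≡ n) → Injective _≡_ _≡_ f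
retraction⇒injective {f} {g} g∘f≗id {m} {n} e = trans (≡-sym (g∘f≗id m)) (trans (cong g e) (g∘f≗id n))

-- twin swaps 2i and 2i + 1, so twin n ≡ suc n says that n is even.
twin : ℕ → ℕ
twin 0             = 1
twin 1             = 0
twin (suc (suc n)) = 2 + twin n

twin-involutive : ∀ n → twin (twin n) ≡ n
twin-involutive 0             = refl
twin-involutive 1             = refl
twin-involutive (suc (suc n)) = cong (2 +_) (twin-involutive n)

twin-injective : Injective _≡_ _≡_ twin
twin-injective = retraction⇒injective {g = twin} twin-involutive

twin≢ : ∀ n → twin n ≢ n
twin≢ (suc (suc n)) e = twin≢ n (suc-injective (suc-injective e))

twin≤suc : ∀ n → twin n ≤ suc n
twin≤suc 0             = ≤-refl
twin≤suc 1             = z≤n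
twin≤suc (suc (suc n)) = s≤s (s≤s (twin≤suc n))

twin-below : ∀ {r j} → j < twin r → j ≢ r → twin j < r
twin-below {0}             {0}             _                 j≢r = ⊥-elim (j≢r refl)
twin-below {0}             {suc _}         (s≤s ())
twin-below {suc (suc r)}   {0}             _                 _   = s≤s (s≤s z≤n)
twin-below {suc (suc r)}   {1}             _                 _   = s≤s z≤n
twin-below {suc (suc r)}   {suc (suc j)}   (s≤s (s≤s j<r′)) j≢r =
  s≤s (s≤s (twin-below j<r′ (j≢r ∘ cong (2 +_))))

twin-parity : ∀ n → twin n ≡ suc n ⊎ twin (suc n) ≡ suc (suc n)
twin-parity 0             = inj₁ refl
twin-parity 1             = inj₂ refl
twin-parity (suc (suc n)) with twin-parity n
... | inj₁ e = inj₁ (cong (2 +_) e)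
... | inj₂ e = inj₂ (cong (2 +_) e)

odd-table : ∀ n → twin n ≡ suc n → Table (suc n)
odd-table n twin-n = record
  { entry           = entry
  ; column-distinct = column-distinct
  ; row-injective   = row-injective
  ; supported       = supported
  ; bounded         = bounded′
  ; top             = n , ≤-refl , cong just twin-n
  }
  where
  entry : K₁₂ → ℕ → Maybe ℕ
  entry hub   i = just i
  entry leaf₁ i = just (twin i)
  entry leaf₂ i = nothing

  column-distinct : ∀ {s s′ i c} → s ≢ s′ → entry s i ≡ just c → entry s′ i ≢ just c
  column-distinct {hub}   {hub}   s≢s′ _ _ = s≢s′ refl
  column-distinct {leaf₁} {leaf₁} s≢s′ _ _ = s≢s′ refl
  column-distinct {hub}   {leaf₁} {i} _ refl e = twin≢ i (just-injective e)
  column-distinct {leaf₁} {hub}   {i} _ refl e = twin≢ i (≡-sym (just-injective e))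
  column-distinct {_}     {leaf₂} _ _ ()
  column-distinct {leaf₂} {_}     _ ()

  row-injective : ∀ {s i i′ c} → entry s i ≡ just c → entry s i′ ≡ just c → i ≡ i′
  row-injective {hub}   refl e = ≡-sym (just-injective e)
  row-injective {leaf₁} refl e = twin-injective (≡-sym (just-injective e))

  supported : ∀ {s i c j} → entry s i ≡ just c → j < c →
              (∃ λ i′ → i′ < i × entry s i′ ≡ just j) ⊎ (∃ λ s′ → K₁₂-Adj s s′ × entry s′ i ≡ just j)
  supported {hub} {i} {j = j} refl j<i = inj₁ (j , j<i , refl)
  supported {leaf₁} {i} {j = j} refl j<c with j ≟ i
  ... | yes refl = inj₂ (hub , leaf₁-hub , refl)
  ... | no  j≢i  = inj₁ (twin j , twin-below j<c j≢i , cong just (twin-involutive j))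

  bounded′ : ∀ {s i c} → i < suc n → entry s i ≡ just c → c ≤ suc n
  bounded′ {hub}   i<k refl = <⇒≤ i<k
  bounded′ {leaf₁} i<k refl = ≤-trans (twin≤suc _) i<k

rotate : ℕ → ℕ
rotate 0                   = 1
rotate 1                   = 2
rotate 2                   = 0
rotate (suc (suc (suc r))) = 3 + r

rotate⁻¹ : ℕ → ℕ
rotate⁻¹ 0                   = 2
rotate⁻¹ 1                   = 0
rotate⁻¹ 2                   = 1
rotate⁻¹ (suc (suc (suc r))) = 3 + r

rotate-injective : Injective _≡_ _≡_ rotate
rotate-injective = retraction⇒injective {g = rotate⁻¹} λ
  { 0 → refl ; 1 → refl ; 2 → refl ; (suc (suc (suc r))) → refl }

twin₃ : ℕ → ℕ
twin₃ 0                   = 0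
twin₃ 1                   = 1
twin₃ 2                   = 2
twin₃ (suc (suc (suc r))) = 3 + twin r

twin₃-injective : Injective _≡_ _≡_ twin₃
twin₃-injective = retraction⇒injective {g = twin₃} λ
  { 0 → refl ; 1 → refl ; 2 → refl ; (suc (suc (suc r))) → cong (3 +_) (twin-involutive r) }

even-table : ∀ m → twin m ≡ suc m → Table (4 + m)
even-table m twin-m = record
  { entry           = entry
  ; column-distinct = column-distinct
  ; row-injective   = row-injective
  ; supported       = supported
  ; bounded         = bounded′
  ; top             = 3 + m , ≤-refl , cong (λ c → just (3 + c)) twin-m
  }
  where
  entry : K₁₂ → ℕ → Maybe ℕ
  entry hub   i = just (rotate i)
  entry leaf₁ i = just (twin₃ i)
  entry leaf₂ 1 = just 0
  entry leaf₂ 2 = just 1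
  entry leaf₂ _ = nothing

  column-distinct : ∀ {s s′ i c} → s ≢ s′ → entry s i ≡ just c → entry s′ i ≢ just c
  column-distinct {hub}   {hub}   s≢s′ _ _ = s≢s′ refl
  column-distinct {leaf₁} {leaf₁} s≢s′ _ _ = s≢s′ refl
  column-distinct {leaf₂} {leaf₂} s≢s′ _ _ = s≢s′ refl
  column-distinct {hub}   {leaf₁} {0} _ refl ()
  column-distinct {hub}   {leaf₁} {1} _ refl ()
  column-distinct {hub}   {leaf₁} {2} _ refl ()
  column-distinct {hub}   {leaf₁} {suc (suc (suc r))} _ refl e = twin≢ r (+-cancelˡ-≡ 3 _ _ (just-injective e))
  column-distinct {leaf₁} {hub}   {0} _ refl ()
  column-distinct {leaf₁} {hub}   {1} _ refl ()
  column-distinct {leaf₁} {hub}   {2} _ refl ()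
  column-distinct {leaf₁} {hub}   {suc (suc (suc r))} _ refl e = twin≢ r (≡-sym (+-cancelˡ-≡ 3 _ _ (just-injective e)))
  column-distinct {s}     {leaf₂} {0} _ _ ()
  column-distinct {hub}   {leaf₂} {1} _ refl ()
  column-distinct {hub}   {leaf₂} {2} _ refl ()
  column-distinct {leaf₁} {leaf₂} {1} _ refl ()
  column-distinct {leaf₁} {leaf₂} {2} _ refl ()
  column-distinct {s}     {leaf₂} {suc (suc (suc r))} _ _ ()
  column-distinct {leaf₂} {s′}    {0} _ ()
  column-distinct {leaf₂} {hub}   {1} _ refl ()
  column-distinct {leaf₂} {hub}   {2} _ refl ()
  column-distinct {leaf₂} {leaf₁} {1} _ refl ()
  column-distinct {leaf₂} {leaf₁} {2} _ refl ()
  column-distinct {leaf₂} {s′}    {suc (suc (suc r))} _ ()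

  row-injective : ∀ {s i i′ c} → entry s i ≡ just c → entry s i′ ≡ just c → i ≡ i′
  row-injective {hub}   {i} {i′} refl e = rotate-injective (≡-sym (just-injective e))
  row-injective {leaf₁} {i} {i′} refl e = twin₃-injective (≡-sym (just-injective e))
  row-injective {leaf₂} {1} {1} _ _ = refl
  row-injective {leaf₂} {2} {2} _ _ = refl
  row-injective {leaf₂} {1} {0} refl ()
  row-injective {leaf₂} {1} {2} refl ()
  row-injective {leaf₂} {1} {suc (suc (suc _))} refl ()
  row-injective {leaf₂} {2} {0} refl ()
  row-injective {leaf₂} {2} {1} refl ()
  row-injective {leaf₂} {2} {suc (suc (suc _))} refl ()
  row-injective {leaf₂} {0} ()
  row-injective {leaf₂} {suc (suc (suc _))} ()

  supported : ∀ {s i c j} → entry s i ≡ just c → j < c →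
              (∃ λ i′ → i′ < i × entry s i′ ≡ just j) ⊎ (∃ λ s′ → K₁₂-Adj s s′ × entry s′ i ≡ just j)
  supported {hub}   {0} refl (s≤s z≤n)       = inj₂ (leaf₁ , hub-leaf₁ , refl)
  supported {hub}   {1} refl (s≤s z≤n)       = inj₂ (leaf₂ , hub-leaf₂ , refl)
  supported {hub}   {1} refl (s≤s (s≤s z≤n)) = inj₁ (0 , s≤s z≤n , refl)
  supported {hub}   {suc (suc (suc r))} {j = 0} refl _ = inj₁ (2 , s≤s (s≤s (s≤s z≤n)) , refl)
  supported {hub}   {suc (suc (suc r))} {j = 1} refl _ = inj₁ (0 , s≤s z≤n , refl)
  supported {hub}   {suc (suc (suc r))} {j = 2} refl _ = inj₁ (1 , s≤s (s≤s z≤n) , refl)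
  supported {hub}   {suc (suc (suc r))} {j = suc (suc (suc j))} refl j<c = inj₁ (3 + j , j<c , refl)
  supported {leaf₁} {1} refl (s≤s z≤n)       = inj₁ (0 , s≤s z≤n , refl)
  supported {leaf₁} {2} {j = 0} refl _       = inj₁ (0 , s≤s z≤n , refl)
  supported {leaf₁} {2} {j = 1} refl _       = inj₁ (1 , s≤s (s≤s z≤n) , refl)
  supported {leaf₁} {2} {j = suc (suc _)} refl (s≤s (s≤s ()))
  supported {leaf₁} {suc (suc (suc r))} {j = 0} refl _ = inj₁ (0 , s≤s z≤n , refl)
  supported {leaf₁} {suc (suc (suc r))} {j = 1} refl _ = inj₁ (1 , s≤s (s≤s z≤n) , refl)
  supported {leaf₁} {suc (suc (suc r))} {j = 2} refl _ = inj₁ (2 , s≤s (s≤s (s≤s z≤n)) , refl)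
  supported {leaf₁} {suc (suc (suc r))} {j = suc (suc (suc j))} refl (s≤s (s≤s (s≤s j<c))) with j ≟ r
  ... | yes refl = inj₂ (hub , leaf₁-hub , refl)
  ... | no  j≢r  = inj₁ (3 + twin j , +-monoʳ-< 3 (twin-below j<c j≢r) ,
                        cong (λ c → just (3 + c)) (twin-involutive j))
  supported {leaf₂} {2} refl (s≤s z≤n)       = inj₁ (1 , s≤s (s≤s z≤n) , refl)

  bounded′ : ∀ {s i c} → i < 4 + m → entry s i ≡ just c → c ≤ 4 + m
  bounded′ {hub}   {0} _ refl = s≤s z≤n
  bounded′ {hub}   {1} _ refl = s≤s (s≤s z≤n)
  bounded′ {hub}   {2} _ refl = z≤n
  bounded′ {hub}   {suc (suc (suc r))} i<k refl = <⇒≤ i<k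
  bounded′ {leaf₁} {0} _ refl = z≤n
  bounded′ {leaf₁} {1} _ refl = s≤s z≤n
  bounded′ {leaf₁} {2} _ refl = s≤s (s≤s z≤n)
  bounded′ {leaf₁} {suc (suc (suc r))} i<k refl = ≤-trans (+-monoʳ-≤ 3 (twin≤suc r)) i<k
  bounded′ {leaf₂} {1} _ refl = z≤n
  bounded′ {leaf₂} {2} _ refl = s≤s z≤n

table : ∀ r → Table (3 + r)
table r with twin-parity (2 + r)
table r       | inj₁ e = odd-table (2 + r) e
table zero    | inj₂ ()
table (suc m) | inj₂ e = even-table m (+-cancelˡ-≡ 4 _ _ e)

-- Graphs of small Grundy number

boundary-edge : ∀ {A : Set} {R : A → A → Set} {P : A → Set} → (∀ x → Dec (P x)) →
                ∀ {s t} → Star R s t → ¬ P s → P t → ∃₂ λ x y → R x y × ¬ P x × P y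
boundary-edge P? ε ¬Ps Pt = ⊥-elim (¬Ps Pt)
boundary-edge P? {s} (_◅_ {j = s′} r walk) ¬Ps Pt with P? s′
... | yes Ps′ = s , s′ , r , ¬Ps , Ps′
... | no ¬Ps′ = boundary-edge P? walk ¬Ps′ Pt

module _ {G : Graph} where

  edge : ∀ {k} → GreedyColouring G (2 + k) → ∃₂ (Adj G)
  edge C with GreedyColouring.nonempty C 1F
  ... | u , cu with GreedyColouring.greedy C u 0F (subst (λ i → 0 < toℕ i) (≡-sym cu) (s≤s z≤n))
  ...   | v , u~v , _ = u , v , u~v

  K₁₂-subgraph-of-colouring : ∀ {r} → GreedyColouring G (3 + r) → K₁₂-Subgraph G
  K₁₂-subgraph-of-colouring {r} C with GreedyColouring.nonempty C (fromℕ (2 + r))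
  ... | x , cx with GreedyColouring.greedy C x 0F (top-above (s≤s z≤n))
                 | GreedyColouring.greedy C x 1F (top-above (s≤s (s≤s z≤n)))
    where
    top-above : ∀ {j} → j < 2 → j < toℕ (GreedyColouring.colour C x)
    top-above {j} j<2 = subst (j <_) (≡-sym (trans (cong toℕ cx) (Fin.toℕ-fromℕ (2 + r))))
                              (≤-trans j<2 (m≤m+n 2 r))
  ... | y , x~y , cy | w , x~w , cw =
    k₁₂-subgraph x~y x~w (λ { refl → Fin.0≢1+n (trans (≡-sym cy) cw) })

  one-colour⇒IsK1 : Connected G → GreedyColouring G 1 → IsK1 G
  one-colour⇒IsK1 (v , walk) C =
    size-unique G (mk↔ₛ′ (λ _ → 0F) (λ _ → v) (λ { 0F → refl ; (Data.Fin.suc ()) }) (λ u → walk⇒≡ (walk v u)))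
    where
    edgeless : ∀ {u w} → ¬ Adj G u w
    edgeless {u} {w} u~w with GreedyColouring.colour C u in cu | GreedyColouring.colour C w in cw
    ... | 0F | 0F = GreedyColouring.stable C u w u~w (trans cu (≡-sym cw))
    walk⇒≡ : ∀ {u w} → Star (Adj G) u w → u ≡ w
    walk⇒≡ ε           = refl
    walk⇒≡ (u~ ◅ _)    = ⊥-elim (edgeless u~)

  two-vertices⇒IsK2 : ∀ {u v} → Adj G u v → (∀ z → z ≡ u ⊎ z ≡ v) → IsK2 G
  two-vertices⇒IsK2 {u} {v} u~v end = size-unique G (mk↔ₛ′ to from to-from from-to) , complete
    where
    to : Vertex G → Fin 2
    to z with end z
    ... | inj₁ _ = 0F
    ... | inj₂ _ = 1F
    from : Fin 2 → Vertex G
    from 0F = u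
    from 1F = v
    to-from : ∀ i → to (from i) ≡ i
    to-from 0F with end u
    ... | inj₁ _    = refl
    ... | inj₂ u≡v  = ⊥-elim (adj⇒≢ G u~v u≡v)
    to-from 1F with end v
    ... | inj₁ v≡u  = ⊥-elim (adj⇒≢ G u~v (≡-sym v≡u))
    ... | inj₂ _    = refl
    from-to : ∀ z → from (to z) ≡ z
    from-to z with end z
    ... | inj₁ z≡u = ≡-sym z≡u
    ... | inj₂ z≡v = ≡-sym z≡v
    complete : IsComplete G
    complete x y x≢y with end x | end y
    ... | inj₁ refl | inj₁ refl = ⊥-elim (x≢y refl)
    ... | inj₁ refl | inj₂ refl = u~v
    ... | inj₂ refl | inj₁ refl = sym G _ _ u~v
    ... | inj₂ refl | inj₂ refl = ⊥-elim (x≢y refl)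

  private
    endpoint? : ∀ {u v} z → Dec (z ≡ u ⊎ z ≡ v)
    endpoint? {u} {v} z = _≟ᵛ_ G z u ⊎-dec _≟ᵛ_ G z v

  K₁₂-subgraph⊎IsK2 : Connected G → ∀ {u v} → Adj G u v → K₁₂-Subgraph G ⊎ IsK2 G
  K₁₂-subgraph⊎IsK2 (_ , walk) {u} {v} u~v with any-vertex? G (λ z → ¬? (endpoint? z))
  ... | yes (z , z∉uv) with boundary-edge endpoint? (walk z u) z∉uv (inj₁ refl)
  ...   | x , .u , x~u , x∉uv , inj₁ refl = inj₁ (k₁₂-subgraph (sym G _ _ x~u) u~v (x∉uv ∘ inj₂))
  ...   | x , .v , x~v , x∉uv , inj₂ refl = inj₁ (k₁₂-subgraph (sym G _ _ x~v) (sym G _ _ u~v) (x∉uv ∘ inj₁))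
  K₁₂-subgraph⊎IsK2 _ {u} {v} u~v | no ∄z =
    inj₂ (two-vertices⇒IsK2 u~v (λ z → decidable-stable (endpoint? z) (λ z∉uv → ∄z (z , z∉uv))))

corollary33 : (G H : Graph) (k : ℕ) →
    Connected G → Connected H → GrundyIs G k → GrundyIs H k →
    ¬ ((IsK1 G × IsK1 H) ⊎ (IsK2 G × IsK2 H)) →
    GrundyAtLeast (G □ H) (suc k)
corollary33 G H 0 (v , _) _ (C , _) _ _ with () ← GreedyColouring.colour C v
corollary33 G H 1 conG conH (CG , _) (CH , _) exceptional =
  ⊥-elim (exceptional (inj₁ (one-colour⇒IsK1 conG CG , one-colour⇒IsK1 conH CH)))
corollary33 G H 2 conG conH (CG , _) (CH , _) exceptional
  with edge CG | edge CH
... | a , b , a~b | x , y , x~y with K₁₂-subgraph⊎IsK2 conG a~b | K₁₂-subgraph⊎IsK2 conH x~y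
...   | inj₁ SG | _       = K₁₂□edge⇒GrundyAtLeast3 SG x~y
...   | inj₂ _  | inj₁ SH = edge□K₁₂⇒GrundyAtLeast3 a~b SH
...   | inj₂ KG | inj₂ KH = ⊥-elim (exceptional (inj₂ (KG , KH)))
corollary33 G H (suc (suc (suc r))) _ _ (CG , _) (CH , _) _ =
  table⇒GrundyAtLeast CG (K₁₂-subgraph-of-colouring CH) (table r)
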